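{- Let $d$ be a positive integer, let $f\colon(\mathbb Z/3\mathbb Z)^d\to[0,1]$, and let $\alpha=\mathbb E_x f(x)$. Then \[\mathbb E_{x,y}\,f(x)\big(1-f(x+y)\big)\big(1-f(x+2y)\big)\leq \frac 32\alpha(1-\alpha)^2,\] where $x,y$ are independent and uniformly distributed in $(\mathbb Z/3\mathbb Z)^d$.
   Formalization: The function f takes values in the rationals of $[0,1]$ rather than in the real interval $[0,1]$. -}

module Defs where

open import Data.Nat using (ℕ; zero; suc)
open import Data.Nat.DivMod using (_mod_)
open import Data.Fin using (Fin; toℕ)
open import Data.Vec using (Vec; []; _∷_; zipWith)
open import Data.Integer using (+_)
open import Data.Rational using (ℚ; _/_; _+_; _*_)
import Data.Nat as ℕ

Z3 : Set
Z3 = Fin 3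

_⊕_ : Z3 → Z3 → Z3
a ⊕ b = (toℕ a ℕ.+ toℕ b) mod 3

G : ℕ → Set
G d = Vec Z3 d

_+ᴳ_ : ∀ {d} → G d → G d → G d
x +ᴳ y = zipWith _⊕_ x y

2·_ : ∀ {d} → G d → G d
2· y = y +ᴳ y

𝔼 : (d : ℕ) → (G d → ℚ) → ℚ
𝔼 zero    g = g []
𝔼 (suc d) g = (+ 1 / 3) * ( 𝔼 d (λ x → g (Fin.zero ∷ x))
                        + 𝔼 d (λ x → g (Fin.suc Fin.zero ∷ x))
                        + 𝔼 d (λ x → g (Fin.suc (Fin.suc Fin.zero) ∷ x)))
  where import Data.Fin as Fin

-- Write f = α + h, so that 𝔼 h = 0 and h ≤ c := 1 − α.  Expanding f(x)(1 − f(x+y))(1 − f(x+2y)),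
-- every term in which h occurs at only one or two of the points x, x + y, x + 2y averages to 0,
-- since any two of these points are independent and uniformly distributed; what remains is
-- α c² + Λ(h, h, h).  As f² ≤ f, 𝔼 h² = 𝔼 f² − α² ≤ α c, so it suffices that Λ(h, h, h) ≤ ½ c 𝔼 h².
--
-- In Fourier terms Λ(h, h, h) = Σᵣ ĥ(r)³, which splits along the lines through 0 of the dual
-- group; each line contributes the same form for a one-dimensional projection of h, which still
-- has mean 0 and is bounded by c.  Here the splitting is done by induction on the dimension.
-- Averaging out the first coordinate isolates the frequencies with r₁ = 0; a function whose
-- first-coordinate fibres have mean 0 splits exactly, for Λ and for 𝔼 (·)², into its three
-- pushforwards along (x₁, x₂, z) ↦ (x₁ − s x₂, z), s ∈ Z/3.  In dimension one a mean-zero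
-- function bounded by c has values a, b, e with a + b + e = 0, and Λ = a b e ≤ (c/6)(a² + b² + e²).

module Submission where

open import Defs
open import Data.Nat using (ℕ; zero; suc; _≤_)
open import Data.Fin using (zero; suc)
open import Data.Vec using ([]; _∷_)
open import Data.Vec.N-ary using (N-ary)
open import Data.Product using (_×_; proj₁; proj₂)
open import Data.Sum using (_⊎_; inj₁; inj₂)
open import Data.Integer using (+_)
open import Data.Rational using (ℚ; 0ℚ; 1ℚ; _/_)
open import Data.Rational.Properties
open import Algebra.Bundles.Raw using (RawRing)
open import Level using (0ℓ)
open import Function using (_∘_)
open import Relation.Binary.PropositionalEquality
open import Relation.Nullary.Decidable.Core using (dec⇒maybe)
open import Tactic.RingSolver.Core.AlmostCommutativeRing using (AlmostCommutativeRing; fromCommutativeRing)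
open import Tactic.RingSolver using (solve-∀)

pattern z0 = zero
pattern z1 = suc zero
pattern z2 = suc (suc zero)

_·_ : Z3 → Z3 → Z3
z0 · s = z0
z1 · s = s
z2 · s = s ⊕ s

-- Written over an arbitrary raw ring so that, instantiated at the ring solver's
-- expressions, the same definitions build the polynomials of the identities below.
module Averages (R : RawRing 0ℓ 0ℓ) (⅓ : RawRing.Carrier R) where
  open RawRing R

  avg : (Z3 → Carrier) → Carrier
  avg u = ⅓ * (u z0 + u z1 + u z2)

  avg² : (Z3 → Z3 → Carrier) → Carrier
  avg² G = avg λ i → avg (G i)

  sq : {X : Set} → (X → Carrier) → X → Carrier
  sq u x = u x * u x

  centre : (Z3 → Carrier) → Z3 → Carrier
  centre u i = u i + - avg u

  Λ : (u v w : Z3 → Carrier) → Carrier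
  Λ u v w = avg² λ i j → u i * v (i ⊕ j) * w (i ⊕ (j ⊕ j))

  Λ² : (U V W : Z3 → Z3 → Carrier) → Carrier
  Λ² U V W = avg² λ i j → Λ (U i) (V (i ⊕ j)) (W (i ⊕ (j ⊕ j)))

  lineAvg : Z3 → (Z3 → Z3 → Carrier) → Z3 → Carrier
  lineAvg s U t = avg λ j → U j (t ⊕ (j · s))

open Averages +-*-rawRing (+ 1 / 3)

open import Data.Rational using (_+_; _*_; _-_; -_; nonNegative; nonPositive) renaming (_≤_ to _≤ℚ_)

ℚ-ring : AlmostCommutativeRing 0ℓ 0ℓ
ℚ-ring = fromCommutativeRing +-*-commutativeRing (λ x → dec⇒maybe (0ℚ ≟ x))

module Poly where
  open import Tactic.RingSolver.NonReflective ℚ-ring public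
    renaming (_⊕_ to _:+_; _⊗_ to _:*_; ⊝_ to :-_)

  exprRing : ℕ → RawRing 0ℓ 0ℓ
  exprRing n = record
    { Carrier = Expr ℚ n ; _≈_ = _≡_ ; _+_ = _:+_ ; _*_ = _:*_ ; -_ = :-_
    ; 0# = Κ 0ℚ ; 1# = Κ 1ℚ }

  infix 4 _:=_
  _:=_ : ∀ {n} → Expr ℚ n → Expr ℚ n → Expr ℚ n × Expr ℚ n
  _:=_ = _⊜_

  module P {n} = Averages (exprRing n) (Κ (+ 1 / 3))

  tab : {X : Set} → X → X → X → Z3 → X
  tab a b c z0 = a
  tab a b c z1 = b
  tab a b c z2 = c

  tab² : {X : Set} → X → X → X → X → X → X → X → X → X → Z3 → Z3 → X
  tab² a₀₀ a₀₁ a₀₂ a₁₀ a₁₁ a₁₂ a₂₀ a₂₁ a₂₂ = tab (tab a₀₀ a₀₁ a₀₂) (tab a₁₀ a₁₁ a₁₂) (tab a₂₀ a₂₁ a₂₂)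

open Poly using (solve; Expr; _:=_; _:*_; _:+_; :-_; Κ; tab; tab²; module P)

-- Averages over Z/3

avg-cong : ∀ {u v} → (∀ i → u i ≡ v i) → avg u ≡ avg v
avg-cong u≗v = cong (+ 1 / 3 *_) (cong₂ _+_ (cong₂ _+_ (u≗v z0) (u≗v z1)) (u≗v z2))

avg-+ : ∀ u v → avg (λ i → u i + v i) ≡ avg u + avg v
avg-+ u v = solve 6 (λ a₀ a₁ a₂ b₀ b₁ b₂ → let a = tab a₀ a₁ a₂ ; b = tab b₀ b₁ b₂ in
  P.avg (λ i → a i :+ b i) := P.avg a :+ P.avg b) refl
  (u z0) (u z1) (u z2) (v z0) (v z1) (v z2)

avg-* : ∀ q u → avg (λ i → q * u i) ≡ q * avg u
avg-* q u = solve 4 (λ q a₀ a₁ a₂ → let a = tab a₀ a₁ a₂ in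
  P.avg (λ i → q :* a i) := q :* P.avg a) refl
  q (u z0) (u z1) (u z2)

avg-neg : ∀ u → avg (λ i → - u i) ≡ - avg u
avg-neg u = solve 3 (λ a₀ a₁ a₂ → let a = tab a₀ a₁ a₂ in
  P.avg (λ i → :- a i) := :- P.avg a) refl
  (u z0) (u z1) (u z2)

avg-const : ∀ q → avg (λ _ → q) ≡ q
avg-const = solve 1 (λ q → P.avg (λ _ → q) := q) refl

avg-mono : ∀ {u v} → (∀ i → u i ≤ℚ v i) → avg u ≤ℚ avg v
avg-mono u≤v = *-monoˡ-≤-nonNeg (+ 1 / 3) (+-mono-≤ (+-mono-≤ (u≤v z0) (u≤v z1)) (u≤v z2))

avg-≤ : ∀ {u c} → (∀ i → u i ≤ℚ c) → avg u ≤ℚ c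
avg-≤ {c = c} u≤c = subst (_ ≤ℚ_) (avg-const c) (avg-mono u≤c)

avg²-shear : ∀ G → avg² (λ i j → G i (i ⊕ j)) ≡ avg² G
avg²-shear G = solve 9 (λ g₀₀ g₀₁ g₀₂ g₁₀ g₁₁ g₁₂ g₂₀ g₂₁ g₂₂ →
  let H = tab² g₀₀ g₀₁ g₀₂ g₁₀ g₁₁ g₁₂ g₂₀ g₂₁ g₂₂ in
  P.avg² (λ i j → H i (i ⊕ j)) := P.avg² H) refl
  (G z0 z0) (G z0 z1) (G z0 z2) (G z1 z0) (G z1 z1) (G z1 z2) (G z2 z0) (G z2 z1) (G z2 z2)

avg²-shear-double : ∀ G → avg² (λ i j → G i (i ⊕ (j ⊕ j))) ≡ avg² G
avg²-shear-double G = solve 9 (λ g₀₀ g₀₁ g₀₂ g₁₀ g₁₁ g₁₂ g₂₀ g₂₁ g₂₂ →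
  let H = tab² g₀₀ g₀₁ g₀₂ g₁₀ g₁₁ g₁₂ g₂₀ g₂₁ g₂₂ in
  P.avg² (λ i j → H i (i ⊕ (j ⊕ j))) := P.avg² H) refl
  (G z0 z0) (G z0 z1) (G z0 z2) (G z1 z0) (G z1 z1) (G z1 z2) (G z2 z0) (G z2 z1) (G z2 z2)

avg²-shear-pair : ∀ G → avg² (λ i j → G (i ⊕ j) (i ⊕ (j ⊕ j))) ≡ avg² G
avg²-shear-pair G = solve 9 (λ g₀₀ g₀₁ g₀₂ g₁₀ g₁₁ g₁₂ g₂₀ g₂₁ g₂₂ →
  let H = tab² g₀₀ g₀₁ g₀₂ g₁₀ g₁₁ g₁₂ g₂₀ g₂₁ g₂₂ in
  P.avg² (λ i j → H (i ⊕ j) (i ⊕ (j ⊕ j))) := P.avg² H) refl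
  (G z0 z0) (G z0 z1) (G z0 z2) (G z1 z0) (G z1 z1) (G z1 z2) (G z2 z0) (G z2 z1) (G z2 z2)

Λ-centre : ∀ u v w → Λ u v w ≡ avg u * avg v * avg w + Λ (centre u) (centre v) (centre w)
Λ-centre u v w = solve 9 (λ a₀ a₁ a₂ b₀ b₁ b₂ c₀ c₁ c₂ →
  let a = tab a₀ a₁ a₂ ; b = tab b₀ b₁ b₂ ; c = tab c₀ c₁ c₂ in
  P.Λ a b c := P.avg a :* P.avg b :* P.avg c :+ P.Λ (P.centre a) (P.centre b) (P.centre c)) refl
  (u z0) (u z1) (u z2) (v z0) (v z1) (v z2) (w z0) (w z1) (w z2)

avg-sq-centre : ∀ u → avg (sq u) ≡ avg u * avg u + avg (sq (centre u))
avg-sq-centre u = solve 3 (λ a₀ a₁ a₂ → let a = tab a₀ a₁ a₂ in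
  P.avg (P.sq a) := P.avg a :* P.avg a :+ P.avg (P.sq (P.centre a))) refl
  (u z0) (u z1) (u z2)

Λ-centre-diagonal : ∀ u → Λ (centre u) (centre u) (centre u) ≡ centre u z0 * centre u z1 * centre u z2
Λ-centre-diagonal u = solve 3 (λ a₀ a₁ a₂ → let a = P.centre (tab a₀ a₁ a₂) in
  P.Λ a a a := a z0 :* a z1 :* a z2) refl
  (u z0) (u z1) (u z2)

centre-sum : ∀ u → centre u z0 + centre u z1 + centre u z2 ≡ 0ℚ
centre-sum u = solve 3 (λ a₀ a₁ a₂ → let a = P.centre (tab a₀ a₁ a₂) in
  a z0 :+ a z1 :+ a z2 := Κ 0ℚ) refl
  (u z0) (u z1) (u z2)

avg-lineAvg : ∀ s U → avg (lineAvg s U) ≡ avg² U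
avg-lineAvg s U = by-cases s
  where
  equation : Z3 → N-ary 9 (Expr ℚ 9) (Expr ℚ 9 × Expr ℚ 9)
  equation s a₀₀ a₀₁ a₀₂ a₁₀ a₁₁ a₁₂ a₂₀ a₂₁ a₂₂ =
    let A = tab² a₀₀ a₀₁ a₀₂ a₁₀ a₁₁ a₁₂ a₂₀ a₂₁ a₂₂ in
    P.avg (P.lineAvg s A) := P.avg² A

  by-cases : ∀ s → avg (lineAvg s U) ≡ avg² U
  by-cases z0 = solve 9 (equation z0) refl
    (U z0 z0) (U z0 z1) (U z0 z2) (U z1 z0) (U z1 z1) (U z1 z2) (U z2 z0) (U z2 z1) (U z2 z2)
  by-cases z1 = solve 9 (equation z1) refl
    (U z0 z0) (U z0 z1) (U z0 z2) (U z1 z0) (U z1 z1) (U z1 z2) (U z2 z0) (U z2 z1) (U z2 z2)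
  by-cases z2 = solve 9 (equation z2) refl
    (U z0 z0) (U z0 z1) (U z0 z2) (U z1 z0) (U z1 z1) (U z1 z2) (U z2 z0) (U z2 z1) (U z2 z2)

-- Centring the columns U j removes the frequencies (r₁, r₂) of Z/3² with r₁ = 0; the others
-- fall into three classes r₂ = −s r₁, and lineAvg s keeps exactly the class s.
Λ²-centre-lines : ∀ U V W →
  Λ² (centre ∘ U) (centre ∘ V) (centre ∘ W) ≡
    Λ (centre (lineAvg z0 U)) (centre (lineAvg z0 V)) (centre (lineAvg z0 W))
  + Λ (centre (lineAvg z1 U)) (centre (lineAvg z1 V)) (centre (lineAvg z1 W))
  + Λ (centre (lineAvg z2 U)) (centre (lineAvg z2 V)) (centre (lineAvg z2 W))
Λ²-centre-lines U V W = solve 27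
  (λ a₀₀ a₀₁ a₀₂ a₁₀ a₁₁ a₁₂ a₂₀ a₂₁ a₂₂ b₀₀ b₀₁ b₀₂ b₁₀ b₁₁ b₁₂ b₂₀ b₂₁ b₂₂
     c₀₀ c₀₁ c₀₂ c₁₀ c₁₁ c₁₂ c₂₀ c₂₁ c₂₂ →
   let A = tab² a₀₀ a₀₁ a₀₂ a₁₀ a₁₁ a₁₂ a₂₀ a₂₁ a₂₂
       B = tab² b₀₀ b₀₁ b₀₂ b₁₀ b₁₁ b₁₂ b₂₀ b₂₁ b₂₂
       C = tab² c₀₀ c₀₁ c₀₂ c₁₀ c₁₁ c₁₂ c₂₀ c₂₁ c₂₂
       line s = P.Λ (P.centre (P.lineAvg s A)) (P.centre (P.lineAvg s B)) (P.centre (P.lineAvg s C))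
   in P.Λ² (P.centre ∘ A) (P.centre ∘ B) (P.centre ∘ C) := line z0 :+ line z1 :+ line z2) refl
  (U z0 z0) (U z0 z1) (U z0 z2) (U z1 z0) (U z1 z1) (U z1 z2) (U z2 z0) (U z2 z1) (U z2 z2)
  (V z0 z0) (V z0 z1) (V z0 z2) (V z1 z0) (V z1 z1) (V z1 z2) (V z2 z0) (V z2 z1) (V z2 z2)
  (W z0 z0) (W z0 z1) (W z0 z2) (W z1 z0) (W z1 z1) (W z1 z2) (W z2 z0) (W z2 z1) (W z2 z2)

avg-sq-centre-lines : ∀ U →
  avg (λ j → avg (sq (centre (U j)))) ≡
    avg (sq (centre (lineAvg z0 U))) + avg (sq (centre (lineAvg z1 U))) + avg (sq (centre (lineAvg z2 U)))
avg-sq-centre-lines U = solve 9 (λ a₀₀ a₀₁ a₀₂ a₁₀ a₁₁ a₁₂ a₂₀ a₂₁ a₂₂ →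
  let A = tab² a₀₀ a₀₁ a₀₂ a₁₀ a₁₁ a₁₂ a₂₀ a₂₁ a₂₂
      line s = P.avg (P.sq (P.centre (P.lineAvg s A)))
  in P.avg (λ j → P.avg (P.sq (P.centre (A j)))) := line z0 :+ line z1 :+ line z2) refl
  (U z0 z0) (U z0 z1) (U z0 z2) (U z1 z0) (U z1 z1) (U z1 z2) (U z2 z0) (U z2 z1) (U z2 z2)

-- Expectations over (Z/3)^d

𝔼-cong : ∀ d {g g' : G d → ℚ} → (∀ x → g x ≡ g' x) → 𝔼 d g ≡ 𝔼 d g'
𝔼-cong zero    g≗g' = g≗g' []
𝔼-cong (suc d) g≗g' = avg-cong λ i → 𝔼-cong d (g≗g' ∘ (i ∷_))

𝔼-+ : ∀ d (g g' : G d → ℚ) → 𝔼 d (λ x → g x + g' x) ≡ 𝔼 d g + 𝔼 d g'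
𝔼-+ zero    g g' = refl
𝔼-+ (suc d) g g' = trans (avg-cong λ i → 𝔼-+ d (g ∘ (i ∷_)) (g' ∘ (i ∷_)))
                         (avg-+ (λ i → 𝔼 d (g ∘ (i ∷_))) (λ i → 𝔼 d (g' ∘ (i ∷_))))

𝔼-* : ∀ d q (g : G d → ℚ) → 𝔼 d (λ x → q * g x) ≡ q * 𝔼 d g
𝔼-* zero    q g = refl
𝔼-* (suc d) q g = trans (avg-cong λ i → 𝔼-* d q (g ∘ (i ∷_))) (avg-* q λ i → 𝔼 d (g ∘ (i ∷_)))

𝔼-neg : ∀ d (g : G d → ℚ) → 𝔼 d (λ x → - g x) ≡ - 𝔼 d g
𝔼-neg zero    g = refl
𝔼-neg (suc d) g = trans (avg-cong λ i → 𝔼-neg d (g ∘ (i ∷_))) (avg-neg λ i → 𝔼 d (g ∘ (i ∷_)))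

𝔼-const : ∀ d q → 𝔼 d (λ _ → q) ≡ q
𝔼-const zero    q = refl
𝔼-const (suc d) q = trans (avg-cong λ _ → 𝔼-const d q) (avg-const q)

𝔼-mono : ∀ d {g g' : G d → ℚ} → (∀ x → g x ≤ℚ g' x) → 𝔼 d g ≤ℚ 𝔼 d g'
𝔼-mono zero    g≤g' = g≤g' []
𝔼-mono (suc d) g≤g' = avg-mono λ i → 𝔼-mono d (g≤g' ∘ (i ∷_))

𝔼-+₃ : ∀ d (g₀ g₁ g₂ : G d → ℚ) → 𝔼 d (λ x → g₀ x + g₁ x + g₂ x) ≡ 𝔼 d g₀ + 𝔼 d g₁ + 𝔼 d g₂
𝔼-+₃ d g₀ g₁ g₂ = trans (𝔼-+ d _ g₂) (cong (_+ 𝔼 d g₂) (𝔼-+ d g₀ g₁))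

𝔼-avg : ∀ d (g : Z3 → G d → ℚ) → 𝔼 d (λ x → avg (λ i → g i x)) ≡ avg (λ i → 𝔼 d (g i))
𝔼-avg d g = trans (𝔼-* d (+ 1 / 3) _) (cong (+ 1 / 3 *_) (𝔼-+₃ d (g z0) (g z1) (g z2)))

fibre : ∀ {d} → (G (suc d) → ℚ) → G d → Z3 → ℚ
fibre g z i = g (i ∷ z)

avg₁ : ∀ {d} → (G (suc d) → ℚ) → G d → ℚ
avg₁ g z = avg (fibre g z)

centre₁ : ∀ {d} → (G (suc d) → ℚ) → G (suc d) → ℚ
centre₁ g (i ∷ z) = centre (fibre g z) i

𝔼-suc : ∀ d (g : G (suc d) → ℚ) → 𝔼 (suc d) g ≡ 𝔼 d (avg₁ g)
𝔼-suc d g = sym (𝔼-avg d λ i z → g (i ∷ z))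

𝔼² : ∀ d → (G d → G d → ℚ) → ℚ
𝔼² d F = 𝔼 d λ x → 𝔼 d (F x)

𝔼²-cong : ∀ d {F F' : G d → G d → ℚ} → (∀ x y → F x y ≡ F' x y) → 𝔼² d F ≡ 𝔼² d F'
𝔼²-cong d F≗F' = 𝔼-cong d λ x → 𝔼-cong d (F≗F' x)

𝔼²-+ : ∀ d (F F' : G d → G d → ℚ) → 𝔼² d (λ x y → F x y + F' x y) ≡ 𝔼² d F + 𝔼² d F'
𝔼²-+ d F F' = trans (𝔼-cong d λ x → 𝔼-+ d (F x) (F' x)) (𝔼-+ d _ _)

𝔼²-+₃ : ∀ d (F₀ F₁ F₂ : G d → G d → ℚ) →
  𝔼² d (λ x y → F₀ x y + F₁ x y + F₂ x y) ≡ 𝔼² d F₀ + 𝔼² d F₁ + 𝔼² d F₂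
𝔼²-+₃ d F₀ F₁ F₂ = trans (𝔼²-+ d _ F₂) (cong (_+ 𝔼² d F₂) (𝔼²-+ d F₀ F₁))

𝔼²-const : ∀ d q → 𝔼² d (λ _ _ → q) ≡ q
𝔼²-const d q = trans (𝔼-cong d λ _ → 𝔼-const d q) (𝔼-const d q)

𝔼²-suc : ∀ d (F : G (suc d) → G (suc d) → ℚ) →
  𝔼² (suc d) F ≡ 𝔼² d (λ x y → avg² λ i j → F (i ∷ x) (j ∷ y))
𝔼²-suc d F = sym (begin
  𝔼 d (λ x → 𝔼 d λ y → avg λ i → avg λ j → F (i ∷ x) (j ∷ y))
    ≡⟨ 𝔼-cong d (λ x → 𝔼-avg d λ i y → avg λ j → F (i ∷ x) (j ∷ y)) ⟩
  𝔼 d (λ x → avg λ i → 𝔼 d λ y → avg λ j → F (i ∷ x) (j ∷ y))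
    ≡⟨ 𝔼-avg d (λ i x → 𝔼 d λ y → avg λ j → F (i ∷ x) (j ∷ y)) ⟩
  avg (λ i → 𝔼 d λ x → 𝔼 d λ y → avg λ j → F (i ∷ x) (j ∷ y))
    ≡⟨ avg-cong (λ i → 𝔼-cong d λ x → 𝔼-avg d λ j y → F (i ∷ x) (j ∷ y)) ⟩
  𝔼² (suc d) F ∎)
  where open ≡-Reasoning

𝔼²-product : ∀ d (g k : G d → ℚ) → 𝔼² d (λ x y → g x * k y) ≡ 𝔼 d g * 𝔼 d k
𝔼²-product d g k = begin
  𝔼 d (λ x → 𝔼 d λ y → g x * k y)  ≡⟨ 𝔼-cong d (λ x → trans (𝔼-* d (g x) k) (*-comm (g x) (𝔼 d k))) ⟩
  𝔼 d (λ x → 𝔼 d k * g x)          ≡⟨ 𝔼-* d (𝔼 d k) g ⟩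
  𝔼 d k * 𝔼 d g                    ≡⟨ *-comm (𝔼 d k) (𝔼 d g) ⟩
  𝔼 d g * 𝔼 d k                    ∎
  where open ≡-Reasoning

𝔼²-shear : ∀ d (F : G d → G d → ℚ) → 𝔼² d (λ x y → F x (x +ᴳ y)) ≡ 𝔼² d F
𝔼²-shear zero    F = refl
𝔼²-shear (suc d) F = begin
  𝔼² (suc d) (λ x y → F x (x +ᴳ y))
    ≡⟨ 𝔼²-suc d (λ x y → F x (x +ᴳ y)) ⟩
  𝔼² d (λ x y → avg² λ i j → F (i ∷ x) ((i ⊕ j) ∷ (x +ᴳ y)))
    ≡⟨ 𝔼²-cong d (λ x y → avg²-shear λ i j → F (i ∷ x) (j ∷ (x +ᴳ y))) ⟩
  𝔼² d (λ x y → avg² λ i j → F (i ∷ x) (j ∷ (x +ᴳ y)))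
    ≡⟨ 𝔼²-shear d (λ x z → avg² λ i j → F (i ∷ x) (j ∷ z)) ⟩
  𝔼² d (λ x z → avg² λ i j → F (i ∷ x) (j ∷ z))
    ≡⟨ 𝔼²-suc d F ⟨
  𝔼² (suc d) F ∎
  where open ≡-Reasoning

𝔼²-shear-double : ∀ d (F : G d → G d → ℚ) → 𝔼² d (λ x y → F x (x +ᴳ (2· y))) ≡ 𝔼² d F
𝔼²-shear-double zero    F = refl
𝔼²-shear-double (suc d) F = begin
  𝔼² (suc d) (λ x y → F x (x +ᴳ (2· y)))
    ≡⟨ 𝔼²-suc d (λ x y → F x (x +ᴳ (2· y))) ⟩
  𝔼² d (λ x y → avg² λ i j → F (i ∷ x) ((i ⊕ (j ⊕ j)) ∷ (x +ᴳ (2· y))))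
    ≡⟨ 𝔼²-cong d (λ x y → avg²-shear-double λ i j → F (i ∷ x) (j ∷ (x +ᴳ (2· y)))) ⟩
  𝔼² d (λ x y → avg² λ i j → F (i ∷ x) (j ∷ (x +ᴳ (2· y))))
    ≡⟨ 𝔼²-shear-double d (λ x z → avg² λ i j → F (i ∷ x) (j ∷ z)) ⟩
  𝔼² d (λ x z → avg² λ i j → F (i ∷ x) (j ∷ z))
    ≡⟨ 𝔼²-suc d F ⟨
  𝔼² (suc d) F ∎
  where open ≡-Reasoning

𝔼²-shear-pair : ∀ d (F : G d → G d → ℚ) → 𝔼² d (λ x y → F (x +ᴳ y) (x +ᴳ (2· y))) ≡ 𝔼² d F
𝔼²-shear-pair zero    F = refl
𝔼²-shear-pair (suc d) F = begin
  𝔼² (suc d) (λ x y → F (x +ᴳ y) (x +ᴳ (2· y)))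
    ≡⟨ 𝔼²-suc d (λ x y → F (x +ᴳ y) (x +ᴳ (2· y))) ⟩
  𝔼² d (λ x y → avg² λ i j → F ((i ⊕ j) ∷ (x +ᴳ y)) ((i ⊕ (j ⊕ j)) ∷ (x +ᴳ (2· y))))
    ≡⟨ 𝔼²-cong d (λ x y → avg²-shear-pair λ i j → F (i ∷ (x +ᴳ y)) (j ∷ (x +ᴳ (2· y)))) ⟩
  𝔼² d (λ x y → avg² λ i j → F (i ∷ (x +ᴳ y)) (j ∷ (x +ᴳ (2· y))))
    ≡⟨ 𝔼²-shear-pair d (λ z z' → avg² λ i j → F (i ∷ z) (j ∷ z')) ⟩
  𝔼² d (λ z z' → avg² λ i j → F (i ∷ z) (j ∷ z'))
    ≡⟨ 𝔼²-suc d F ⟨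
  𝔼² (suc d) F ∎
  where open ≡-Reasoning

-- The 3-AP form

Λᴳ : ∀ d → (u v w : G d → ℚ) → ℚ
Λᴳ d u v w = 𝔼² d λ x y → u x * v (x +ᴳ y) * w (x +ᴳ (2· y))

centreᴳ : ∀ d → (G d → ℚ) → G d → ℚ
centreᴳ d u x = u x - 𝔼 d u

𝔼-centreᴳ : ∀ d (u : G d → ℚ) → 𝔼 d (centreᴳ d u) ≡ 0ℚ
𝔼-centreᴳ d u = begin
  𝔼 d (λ x → u x - 𝔼 d u)           ≡⟨ 𝔼-+ d u (λ _ → - 𝔼 d u) ⟩
  𝔼 d u + 𝔼 d (λ _ → - 𝔼 d u)       ≡⟨ cong (λ t → 𝔼 d u + t) (𝔼-const d (- 𝔼 d u)) ⟩
  𝔼 d u - 𝔼 d u                     ≡⟨ +-inverseʳ (𝔼 d u) ⟩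
  0ℚ                                ∎
  where open ≡-Reasoning

𝔼²-product-zeroˡ : ∀ d {g : G d → ℚ} (k : G d → ℚ) → 𝔼 d g ≡ 0ℚ → 𝔼² d (λ x y → g x * k y) ≡ 0ℚ
𝔼²-product-zeroˡ d {g} k 𝔼g≡0 =
  trans (𝔼²-product d g k) (trans (cong (_* 𝔼 d k) 𝔼g≡0) (*-zeroˡ (𝔼 d k)))

𝔼²-product-zeroʳ : ∀ d (g : G d → ℚ) {k : G d → ℚ} → 𝔼 d k ≡ 0ℚ → 𝔼² d (λ x y → g x * k y) ≡ 0ℚ
𝔼²-product-zeroʳ d g {k} 𝔼k≡0 =
  trans (𝔼²-product d g k) (trans (cong (𝔼 d g *_) 𝔼k≡0) (*-zeroʳ (𝔼 d g)))

Λᴳ-centre : ∀ d (u v w : G d → ℚ) →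
  Λᴳ d u v w ≡ 𝔼 d u * 𝔼 d v * 𝔼 d w + Λᴳ d (centreᴳ d u) (centreᴳ d v) (centreᴳ d w)
Λᴳ-centre d u v w = begin
  Λᴳ d u v w
    ≡⟨ 𝔼²-cong d (λ x y → expand (u x) (v (x +ᴳ y)) (w (x +ᴳ (2· y))) a b e) ⟩
  𝔼² d (λ x y → (a * b * e + U x * V (x +ᴳ y) * W (x +ᴳ (2· y))) + (P x y + Q x y + R x y))
    ≡⟨ 𝔼²-+ d _ (λ x y → P x y + Q x y + R x y) ⟩
  𝔼² d (λ x y → a * b * e + U x * V (x +ᴳ y) * W (x +ᴳ (2· y))) + 𝔼² d (λ x y → P x y + Q x y + R x y)
    ≡⟨ cong₂ _+_ (trans (𝔼²-+ d (λ _ _ → a * b * e) _) (cong (_+ Λᴳ d U V W) (𝔼²-const d _))) negligible ⟩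
  a * b * e + Λᴳ d U V W + 0ℚ
    ≡⟨ +-identityʳ _ ⟩
  a * b * e + Λᴳ d U V W ∎
  where
  open ≡-Reasoning
  a b e : ℚ
  a = 𝔼 d u ; b = 𝔼 d v ; e = 𝔼 d w
  U V W : G d → ℚ
  U = centreᴳ d u ; V = centreᴳ d v ; W = centreᴳ d w
  P Q R : G d → G d → ℚ
  P x y = U x * (b * e + e * V (x +ᴳ y))
  Q x y = (a * b + b * U x) * W (x +ᴳ (2· y))
  R x y = V (x +ᴳ y) * (a * e + a * W (x +ᴳ (2· y)))

  expand : ∀ u v w a b e → u * v * w ≡ (a * b * e + (u - a) * (v - b) * (w - e)) +
    ((u - a) * (b * e + e * (v - b)) + (a * b + b * (u - a)) * (w - e) + (v - b) * (a * e + a * (w - e)))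
  expand = solve-∀ ℚ-ring

  𝔼²P≡0 : 𝔼² d P ≡ 0ℚ
  𝔼²P≡0 = trans (𝔼²-shear d λ s t → U s * (b * e + e * V t))
                (𝔼²-product-zeroˡ d (λ t → b * e + e * V t) (𝔼-centreᴳ d u))
  𝔼²Q≡0 : 𝔼² d Q ≡ 0ℚ
  𝔼²Q≡0 = trans (𝔼²-shear-double d λ s t → (a * b + b * U s) * W t)
                (𝔼²-product-zeroʳ d (λ s → a * b + b * U s) (𝔼-centreᴳ d w))
  𝔼²R≡0 : 𝔼² d R ≡ 0ℚ
  𝔼²R≡0 = trans (𝔼²-shear-pair d λ s t → V s * (a * e + a * W t))
                (𝔼²-product-zeroˡ d (λ t → a * e + a * W t) (𝔼-centreᴳ d v))

  negligible : 𝔼² d (λ x y → P x y + Q x y + R x y) ≡ 0ℚ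
  negligible = trans (𝔼²-+₃ d P Q R) (cong₂ _+_ (cong₂ _+_ 𝔼²P≡0 𝔼²Q≡0) 𝔼²R≡0)

𝔼-complement : ∀ d (f : G d → ℚ) → 𝔼 d (λ x → 1ℚ - f x) ≡ 1ℚ - 𝔼 d f
𝔼-complement d f = trans (𝔼-+ d (λ _ → 1ℚ) (λ x → - f x)) (cong₂ _+_ (𝔼-const d 1ℚ) (𝔼-neg d f))

Λᴳ-neg-neg : ∀ d (u v w : G d → ℚ) → Λᴳ d u (λ x → - v x) (λ x → - w x) ≡ Λᴳ d u v w
Λᴳ-neg-neg d u v w = 𝔼²-cong d λ x y → signs (u x) (v (x +ᴳ y)) (w (x +ᴳ (2· y)))
  where
  signs : ∀ a b e → a * - b * - e ≡ a * b * e
  signs = solve-∀ ℚ-ring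

Λᴳ-complement : ∀ d (f : G d → ℚ) → let α = 𝔼 d f ; h = centreᴳ d f in
  Λᴳ d f (λ x → 1ℚ - f x) (λ x → 1ℚ - f x) ≡ α * (1ℚ - α) * (1ℚ - α) + Λᴳ d h h h
Λᴳ-complement d f = begin
  Λᴳ d f f̄ f̄
    ≡⟨ Λᴳ-centre d f f̄ f̄ ⟩
  α * 𝔼 d f̄ * 𝔼 d f̄ + Λᴳ d h (centreᴳ d f̄) (centreᴳ d f̄)
    ≡⟨ cong₂ (λ β t → α * β * β + t) (𝔼-complement d f)
             (𝔼²-cong d λ x y → cong₂ (λ p q → h x * p * q) (centreᴳ-f̄ (x +ᴳ y)) (centreᴳ-f̄ (x +ᴳ (2· y)))) ⟩
  α * (1ℚ - α) * (1ℚ - α) + Λᴳ d h (λ x → - h x) (λ x → - h x)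
    ≡⟨ cong (λ t → α * (1ℚ - α) * (1ℚ - α) + t) (Λᴳ-neg-neg d h h h) ⟩
  α * (1ℚ - α) * (1ℚ - α) + Λᴳ d h h h ∎
  where
  open ≡-Reasoning
  α : ℚ
  α = 𝔼 d f
  f̄ h : G d → ℚ
  f̄ x = 1ℚ - f x
  h = centreᴳ d f
  flip : ∀ u α → 1ℚ - u - (1ℚ - α) ≡ - (u - α)
  flip = solve-∀ ℚ-ring
  centreᴳ-f̄ : ∀ x → centreᴳ d f̄ x ≡ - h x
  centreᴳ-f̄ x = trans (cong (λ β → 1ℚ - f x - β) (𝔼-complement d f)) (flip (f x) α)

-- Lowering the dimension

Λᴳ-suc : ∀ d (u v w : G (suc d) → ℚ) →
  Λᴳ (suc d) u v w ≡ 𝔼² d (λ x y → Λ (fibre u x) (fibre v (x +ᴳ y)) (fibre w (x +ᴳ (2· y))))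
Λᴳ-suc d u v w = 𝔼²-suc d λ x y → u x * v (x +ᴳ y) * w (x +ᴳ (2· y))

Λᴳ-avg₁-centre₁ : ∀ d (u v w : G (suc d) → ℚ) →
  Λᴳ (suc d) u v w ≡ Λᴳ d (avg₁ u) (avg₁ v) (avg₁ w) + Λᴳ (suc d) (centre₁ u) (centre₁ v) (centre₁ w)
Λᴳ-avg₁-centre₁ d u v w = begin
  Λᴳ (suc d) u v w
    ≡⟨ Λᴳ-suc d u v w ⟩
  𝔼² d (λ x y → Λ (fibre u x) (fibre v (x +ᴳ y)) (fibre w (x +ᴳ (2· y))))
    ≡⟨ 𝔼²-cong d (λ x y → Λ-centre (fibre u x) (fibre v (x +ᴳ y)) (fibre w (x +ᴳ (2· y)))) ⟩
  𝔼² d (λ x y → avg₁ u x * avg₁ v (x +ᴳ y) * avg₁ w (x +ᴳ (2· y))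
              + Λ (fibre (centre₁ u) x) (fibre (centre₁ v) (x +ᴳ y)) (fibre (centre₁ w) (x +ᴳ (2· y))))
    ≡⟨ 𝔼²-+ d _ _ ⟩
  Λᴳ d (avg₁ u) (avg₁ v) (avg₁ w)
    + 𝔼² d (λ x y → Λ (fibre (centre₁ u) x) (fibre (centre₁ v) (x +ᴳ y)) (fibre (centre₁ w) (x +ᴳ (2· y))))
    ≡⟨ cong (λ t → Λᴳ d (avg₁ u) (avg₁ v) (avg₁ w) + t) (Λᴳ-suc d (centre₁ u) (centre₁ v) (centre₁ w)) ⟨
  Λᴳ d (avg₁ u) (avg₁ v) (avg₁ w) + Λᴳ (suc d) (centre₁ u) (centre₁ v) (centre₁ w) ∎
  where open ≡-Reasoning

𝔼-sq-avg₁-centre₁ : ∀ d (g : G (suc d) → ℚ) →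
  𝔼 (suc d) (sq g) ≡ 𝔼 d (sq (avg₁ g)) + 𝔼 (suc d) (sq (centre₁ g))
𝔼-sq-avg₁-centre₁ d g = begin
  𝔼 (suc d) (sq g)
    ≡⟨ 𝔼-suc d (sq g) ⟩
  𝔼 d (λ z → avg (sq (fibre g z)))
    ≡⟨ 𝔼-cong d (λ z → avg-sq-centre (fibre g z)) ⟩
  𝔼 d (λ z → sq (avg₁ g) z + avg (sq (fibre (centre₁ g) z)))
    ≡⟨ 𝔼-+ d _ _ ⟩
  𝔼 d (sq (avg₁ g)) + 𝔼 d (λ z → avg (sq (fibre (centre₁ g) z)))
    ≡⟨ cong (λ t → 𝔼 d (sq (avg₁ g)) + t) (𝔼-suc d (sq (centre₁ g))) ⟨
  𝔼 d (sq (avg₁ g)) + 𝔼 (suc d) (sq (centre₁ g)) ∎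
  where open ≡-Reasoning

block : ∀ {m} → (G (suc (suc m)) → ℚ) → G m → Z3 → Z3 → ℚ
block g z j = fibre g (j ∷ z)

push : ∀ {m} → Z3 → (G (suc (suc m)) → ℚ) → G (suc m) → ℚ
push s g (t ∷ z) = lineAvg s (block g z) t

𝔼-suc² : ∀ m (g : G (suc (suc m)) → ℚ) → 𝔼 (suc (suc m)) g ≡ 𝔼 m (λ z → avg² (block g z))
𝔼-suc² m g = trans (𝔼-suc (suc m) g) (𝔼-suc m (avg₁ g))

𝔼-push : ∀ {m} s (g : G (suc (suc m)) → ℚ) → 𝔼 (suc m) (push s g) ≡ 𝔼 (suc (suc m)) g
𝔼-push {m} s g = begin
  𝔼 (suc m) (push s g)                        ≡⟨ 𝔼-suc m (push s g) ⟩
  𝔼 m (λ z → avg (lineAvg s (block g z)))     ≡⟨ 𝔼-cong m (λ z → avg-lineAvg s (block g z)) ⟩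
  𝔼 m (λ z → avg² (block g z))                ≡⟨ 𝔼-suc² m g ⟨
  𝔼 (suc (suc m)) g                           ∎
  where open ≡-Reasoning

push-≤ : ∀ {m c} s (g : G (suc (suc m)) → ℚ) → (∀ x → g x ≤ℚ c) → ∀ x → push s g x ≤ℚ c
push-≤ s g g≤c (t ∷ z) = avg-≤ λ j → g≤c ((t ⊕ (j · s)) ∷ j ∷ z)

Λᴳ-suc² : ∀ m (u v w : G (suc (suc m)) → ℚ) →
  Λᴳ (suc (suc m)) u v w ≡ 𝔼² m (λ x y → Λ² (block u x) (block v (x +ᴳ y)) (block w (x +ᴳ (2· y))))
Λᴳ-suc² m u v w = trans (Λᴳ-suc (suc m) u v w)
  (𝔼²-suc m λ x y → Λ (fibre u x) (fibre v (x +ᴳ y)) (fibre w (x +ᴳ (2· y))))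

Λᴳ-centre₁-lines : ∀ m (u v w : G (suc (suc m)) → ℚ) →
  Λᴳ (suc (suc m)) (centre₁ u) (centre₁ v) (centre₁ w) ≡
      Λᴳ (suc m) (centre₁ (push z0 u)) (centre₁ (push z0 v)) (centre₁ (push z0 w))
    + Λᴳ (suc m) (centre₁ (push z1 u)) (centre₁ (push z1 v)) (centre₁ (push z1 w))
    + Λᴳ (suc m) (centre₁ (push z2 u)) (centre₁ (push z2 v)) (centre₁ (push z2 w))
Λᴳ-centre₁-lines m u v w = begin
  Λᴳ (suc (suc m)) (centre₁ u) (centre₁ v) (centre₁ w)
    ≡⟨ Λᴳ-suc² m (centre₁ u) (centre₁ v) (centre₁ w) ⟩
  𝔼² m (λ x y → Λ² (centre ∘ block u x) (centre ∘ block v (x +ᴳ y)) (centre ∘ block w (x +ᴳ (2· y))))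
    ≡⟨ 𝔼²-cong m (λ x y → Λ²-centre-lines (block u x) (block v (x +ᴳ y)) (block w (x +ᴳ (2· y)))) ⟩
  𝔼² m (λ x y → line z0 x y + line z1 x y + line z2 x y)
    ≡⟨ 𝔼²-+₃ m (line z0) (line z1) (line z2) ⟩
  𝔼² m (line z0) + 𝔼² m (line z1) + 𝔼² m (line z2)
    ≡⟨ cong₂ _+_ (cong₂ _+_ (line-Λᴳ z0) (line-Λᴳ z1)) (line-Λᴳ z2) ⟨
  _ ∎
  where
  open ≡-Reasoning
  line : Z3 → G m → G m → ℚ
  line s x y = Λ (centre (lineAvg s (block u x))) (centre (lineAvg s (block v (x +ᴳ y))))
                 (centre (lineAvg s (block w (x +ᴳ (2· y)))))
  line-Λᴳ : ∀ s → Λᴳ (suc m) (centre₁ (push s u)) (centre₁ (push s v)) (centre₁ (push s w)) ≡ 𝔼² m (line s)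
  line-Λᴳ s = Λᴳ-suc m (centre₁ (push s u)) (centre₁ (push s v)) (centre₁ (push s w))

𝔼-sq-centre₁-lines : ∀ m (g : G (suc (suc m)) → ℚ) →
  𝔼 (suc (suc m)) (sq (centre₁ g)) ≡
      𝔼 (suc m) (sq (centre₁ (push z0 g)))
    + 𝔼 (suc m) (sq (centre₁ (push z1 g)))
    + 𝔼 (suc m) (sq (centre₁ (push z2 g)))
𝔼-sq-centre₁-lines m g = begin
  𝔼 (suc (suc m)) (sq (centre₁ g))
    ≡⟨ 𝔼-suc² m (sq (centre₁ g)) ⟩
  𝔼 m (λ z → avg λ j → avg (sq (centre (block g z j))))
    ≡⟨ 𝔼-cong m (λ z → avg-sq-centre-lines (block g z)) ⟩
  𝔼 m (λ z → line z0 z + line z1 z + line z2 z)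
    ≡⟨ 𝔼-+₃ m (line z0) (line z1) (line z2) ⟩
  𝔼 m (line z0) + 𝔼 m (line z1) + 𝔼 m (line z2)
    ≡⟨ cong₂ _+_ (cong₂ _+_ (line-𝔼 z0) (line-𝔼 z1)) (line-𝔼 z2) ⟨
  _ ∎
  where
  open ≡-Reasoning
  line : Z3 → G m → ℚ
  line s z = avg (sq (centre (lineAvg s (block g z))))
  line-𝔼 : ∀ s → 𝔼 (suc m) (sq (centre₁ (push s g))) ≡ 𝔼 m (line s)
  line-𝔼 s = 𝔼-suc m (sq (centre₁ (push s g)))

½ : ℚ
½ = + 1 / 2

p≤q⇒0≤q-p : ∀ {p q} → p ≤ℚ q → 0ℚ ≤ℚ q - p
p≤q⇒0≤q-p {p} {q} p≤q = subst (_≤ℚ q - p) (+-inverseʳ p) (+-monoˡ-≤ (- p) p≤q)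

0≤q-p⇒p≤q : ∀ {p q} → 0ℚ ≤ℚ q - p → p ≤ℚ q
0≤q-p⇒p≤q {p} {q} 0≤q-p = subst₂ _≤ℚ_ (+-identityˡ p) (cancel q p) (+-monoˡ-≤ p 0≤q-p)
  where
  cancel : ∀ q p → q - p + p ≡ q
  cancel = solve-∀ ℚ-ring

*-nonNeg : ∀ {p q} → 0ℚ ≤ℚ p → 0ℚ ≤ℚ q → 0ℚ ≤ℚ p * q
*-nonNeg {p} {q} 0≤p 0≤q =
  nonNegative⁻¹ (p * q) {{nonNeg*nonNeg⇒nonNeg p {{nonNegative 0≤p}} q {{nonNegative 0≤q}}}}

+-nonNeg : ∀ {p q} → 0ℚ ≤ℚ p → 0ℚ ≤ℚ q → 0ℚ ≤ℚ p + q
+-nonNeg {p} {q} 0≤p 0≤q =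
  nonNegative⁻¹ (p + q) {{nonNeg+nonNeg⇒nonNeg p {{nonNegative 0≤p}} q {{nonNegative 0≤q}}}}

square-nonNeg : ∀ p → 0ℚ ≤ℚ p * p
square-nonNeg p with ≤-total 0ℚ p
... | inj₁ 0≤p = *-nonNeg 0≤p 0≤p
... | inj₂ p≤0 = nonNegative⁻¹ (p * p) {{nonPos*nonPos⇒nonPos p {{nonPositive p≤0}} p {{nonPositive p≤0}}}}

zero-sum-bound-core : ∀ {a b e c} → 0ℚ ≤ℚ a → a ≤ℚ c → a + b + e ≡ 0ℚ →
  a * b * e ≤ℚ ½ * c * (+ 1 / 3 * (a * a + b * b + e * e))
zero-sum-bound-core {a} {b} {e} {c} 0≤a a≤c sum≡0 = 0≤q-p⇒p≤q (begin
  0ℚ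
    ≤⟨ +-nonNeg (*-nonNeg (*-nonNeg (nonNegative⁻¹ (+ 1 / 4)) (square-nonNeg a)) (p≤q⇒0≤q-p a≤c))
                (*-nonNeg (square-nonNeg (b - e))
                  (+-nonNeg (*-nonNeg (≤-trans 0≤a a≤c) (nonNegative⁻¹ (+ 1 / 12)))
                            (*-nonNeg 0≤a (nonNegative⁻¹ (+ 1 / 4))))) ⟩
  N
    ≡⟨ +-identityʳ N ⟨
  N + 0ℚ
    ≡⟨ cong (λ s → N + s) (*-zeroˡ K) ⟨
  N + 0ℚ * K
    ≡⟨ cong (λ s → N + s * K) sum≡0 ⟨
  N + (a + b + e) * K
    ≡⟨ certificate a b e c ⟨
  ½ * c * (+ 1 / 3 * (a * a + b * b + e * e)) - a * b * e ∎)
  where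
  open ≤-Reasoning
  N K : ℚ
  N = + 1 / 4 * (a * a) * (c - a) + (b - e) * (b - e) * (c * (+ 1 / 12) + a * (+ 1 / 4))
  K = c * (b + e - a) * (+ 1 / 12) + a * (a - b - e) * (+ 1 / 4)
  certificate : ∀ a b e c → ½ * c * (+ 1 / 3 * (a * a + b * b + e * e)) - a * b * e ≡
    + 1 / 4 * (a * a) * (c - a) + (b - e) * (b - e) * (c * (+ 1 / 12) + a * (+ 1 / 4))
    + (a + b + e) * (c * (b + e - a) * (+ 1 / 12) + a * (a - b - e) * (+ 1 / 4))
  certificate = solve-∀ ℚ-ring

zero-sum-nonNeg : ∀ {a b e} → a + b + e ≡ 0ℚ → a ≤ℚ 0ℚ → b ≤ℚ 0ℚ → 0ℚ ≤ℚ e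
zero-sum-nonNeg {a} {b} {e} sum≡0 a≤0 b≤0 = begin
  0ℚ                       ≤⟨ neg-antimono-≤ (+-mono-≤ a≤0 b≤0) ⟩
  - (a + b)                ≡⟨ +-identityˡ (- (a + b)) ⟨
  0ℚ - (a + b)             ≡⟨ cong (_- (a + b)) sum≡0 ⟨
  a + b + e - (a + b)      ≡⟨ cancel a b e ⟩
  e                        ∎
  where
  open ≤-Reasoning
  cancel : ∀ a b e → a + b + e - (a + b) ≡ e
  cancel = solve-∀ ℚ-ring

zero-sum-bound : ∀ {a b e c} → a + b + e ≡ 0ℚ → a ≤ℚ c → b ≤ℚ c → e ≤ℚ c →
  a * b * e ≤ℚ ½ * c * (+ 1 / 3 * (a * a + b * b + e * e))
zero-sum-bound {a} {b} {e} {c} sum≡0 a≤c b≤c e≤c = by-sign (≤-total 0ℚ a) (≤-total 0ℚ b)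
  where
  rotate-sum : ∀ a b e → b + e + a ≡ a + b + e
  rotate-sum = solve-∀ ℚ-ring
  rotate-product : ∀ a b e → b * e * a ≡ a * b * e
  rotate-product = solve-∀ ℚ-ring
  rotate-squares : ∀ a b e → b * b + e * e + a * a ≡ a * a + b * b + e * e
  rotate-squares = solve-∀ ℚ-ring

  rotate : ∀ a b e → b * e * a ≤ℚ ½ * c * (+ 1 / 3 * (b * b + e * e + a * a)) →
                     a * b * e ≤ℚ ½ * c * (+ 1 / 3 * (a * a + b * b + e * e))
  rotate a b e =
    subst₂ _≤ℚ_ (rotate-product a b e) (cong (λ t → ½ * c * (+ 1 / 3 * t)) (rotate-squares a b e))

  by-sign : 0ℚ ≤ℚ a ⊎ a ≤ℚ 0ℚ → 0ℚ ≤ℚ b ⊎ b ≤ℚ 0ℚ →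
            a * b * e ≤ℚ ½ * c * (+ 1 / 3 * (a * a + b * b + e * e))
  by-sign (inj₁ 0≤a) _          = zero-sum-bound-core 0≤a a≤c sum≡0
  by-sign (inj₂ _)   (inj₁ 0≤b) =
    rotate a b e (zero-sum-bound-core 0≤b b≤c (trans (rotate-sum a b e) sum≡0))
  by-sign (inj₂ a≤0) (inj₂ b≤0) =
    rotate a b e (rotate b e a (zero-sum-bound-core (zero-sum-nonNeg sum≡0 a≤0 b≤0) e≤c
      (trans (rotate-sum b e a) (trans (rotate-sum a b e) sum≡0))))

Λ-centre-bound : ∀ {c} u → (∀ i → u i ≤ℚ c) → avg u ≡ 0ℚ →
  Λ (centre u) (centre u) (centre u) ≤ℚ ½ * c * avg (sq (centre u))
Λ-centre-bound {c} u u≤c avg≡0 = begin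
  Λ (centre u) (centre u) (centre u)
    ≡⟨ Λ-centre-diagonal u ⟩
  centre u z0 * centre u z1 * centre u z2
    ≤⟨ zero-sum-bound (centre-sum u) (centre≤ z0) (centre≤ z1) (centre≤ z2) ⟩
  ½ * c * avg (sq (centre u)) ∎
  where
  open ≤-Reasoning
  centre≤ : ∀ i → centre u i ≤ℚ c
  centre≤ i = subst (_≤ℚ c) (trans (sym (+-identityʳ (u i))) (cong (λ m → u i - m) (sym avg≡0))) (u≤c i)

Λᴳ-centre₁-bound : ∀ m {c} (g : G (suc m) → ℚ) → (∀ x → g x ≤ℚ c) → 𝔼 (suc m) g ≡ 0ℚ →
  Λᴳ (suc m) (centre₁ g) (centre₁ g) (centre₁ g) ≤ℚ ½ * c * 𝔼 (suc m) (sq (centre₁ g))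
Λᴳ-centre₁-bound zero    g g≤c 𝔼g≡0 = Λ-centre-bound (fibre g []) (λ i → g≤c (i ∷ [])) 𝔼g≡0
Λᴳ-centre₁-bound (suc m) {c} g g≤c 𝔼g≡0 = begin
  Λᴳ (suc (suc m)) (centre₁ g) (centre₁ g) (centre₁ g)
    ≡⟨ Λᴳ-centre₁-lines m g g g ⟩
  Λ₁ z0 + Λ₁ z1 + Λ₁ z2
    ≤⟨ +-mono-≤ (+-mono-≤ (line-bound z0) (line-bound z1)) (line-bound z2) ⟩
  ½ * c * E₁ z0 + ½ * c * E₁ z1 + ½ * c * E₁ z2
    ≡⟨ distrib (½ * c) (E₁ z0) (E₁ z1) (E₁ z2) ⟩
  ½ * c * (E₁ z0 + E₁ z1 + E₁ z2)
    ≡⟨ cong (½ * c *_) (𝔼-sq-centre₁-lines m g) ⟨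
  ½ * c * 𝔼 (suc (suc m)) (sq (centre₁ g)) ∎
  where
  open ≤-Reasoning
  Λ₁ E₁ : Z3 → ℚ
  Λ₁ s = Λᴳ (suc m) (centre₁ (push s g)) (centre₁ (push s g)) (centre₁ (push s g))
  E₁ s = 𝔼 (suc m) (sq (centre₁ (push s g)))
  line-bound : ∀ s → Λ₁ s ≤ℚ ½ * c * E₁ s
  line-bound s = Λᴳ-centre₁-bound m (push s g) (push-≤ s g g≤c) (trans (𝔼-push s g) 𝔼g≡0)
  distrib : ∀ k p q r → k * p + k * q + k * r ≡ k * (p + q + r)
  distrib = solve-∀ ℚ-ring

Λᴳ-mean-zero-bound : ∀ d {c} (h : G d → ℚ) → (∀ x → h x ≤ℚ c) → 𝔼 d h ≡ 0ℚ →
  Λᴳ d h h h ≤ℚ ½ * c * 𝔼 d (sq h)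
Λᴳ-mean-zero-bound zero {c} h _ h≡0 = ≤-reflexive (begin-equality
  h [] * h [] * h []         ≡⟨ cong (λ a → a * a * a) h≡0 ⟩
  0ℚ                         ≡⟨ *-zeroʳ (½ * c) ⟨
  ½ * c * (0ℚ * 0ℚ)          ≡⟨ cong (λ a → ½ * c * (a * a)) h≡0 ⟨
  ½ * c * (h [] * h [])      ∎)
  where open ≤-Reasoning
Λᴳ-mean-zero-bound (suc d) {c} h h≤c 𝔼h≡0 = begin
  Λᴳ (suc d) h h h
    ≡⟨ Λᴳ-avg₁-centre₁ d h h h ⟩
  Λᴳ d (avg₁ h) (avg₁ h) (avg₁ h) + Λᴳ (suc d) (centre₁ h) (centre₁ h) (centre₁ h)
    ≤⟨ +-mono-≤ (Λᴳ-mean-zero-bound d (avg₁ h) avg₁h≤c (trans (sym (𝔼-suc d h)) 𝔼h≡0))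
                (Λᴳ-centre₁-bound d h h≤c 𝔼h≡0) ⟩
  ½ * c * 𝔼 d (sq (avg₁ h)) + ½ * c * 𝔼 (suc d) (sq (centre₁ h))
    ≡⟨ *-distribˡ-+ (½ * c) _ _ ⟨
  ½ * c * (𝔼 d (sq (avg₁ h)) + 𝔼 (suc d) (sq (centre₁ h)))
    ≡⟨ cong (½ * c *_) (𝔼-sq-avg₁-centre₁ d h) ⟨
  ½ * c * 𝔼 (suc d) (sq h) ∎
  where
  open ≤-Reasoning
  avg₁h≤c : ∀ z → avg₁ h z ≤ℚ c
  avg₁h≤c z = avg-≤ λ i → h≤c (i ∷ z)

𝔼-sq-centreᴳ-≤ : ∀ d (f : G d → ℚ) → (∀ x → 0ℚ ≤ℚ f x) → (∀ x → f x ≤ℚ 1ℚ) →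
  𝔼 d (sq (centreᴳ d f)) ≤ℚ 𝔼 d f * (1ℚ - 𝔼 d f)
𝔼-sq-centreᴳ-≤ d f 0≤f f≤1 = begin
  𝔼 d (sq (centreᴳ d f))                       ≤⟨ 𝔼-mono d pointwise ⟩
  𝔼 d (λ x → (1ℚ - 2α) * f x + α * α)          ≡⟨ 𝔼-+ d _ _ ⟩
  𝔼 d (λ x → (1ℚ - 2α) * f x) + 𝔼 d (λ _ → α * α)
    ≡⟨ cong₂ _+_ (𝔼-* d (1ℚ - 2α) f) (𝔼-const d (α * α)) ⟩
  (1ℚ - 2α) * α + α * α                        ≡⟨ collect α ⟩
  α * (1ℚ - α)                                 ∎
  where
  open ≤-Reasoning
  α 2α : ℚ
  α = 𝔼 d f
  2α = + 2 / 1 * α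
  gap : ∀ u α → (1ℚ - + 2 / 1 * α) * u + α * α - (u - α) * (u - α) ≡ u - u * u
  gap = solve-∀ ℚ-ring
  collect : ∀ α → (1ℚ - + 2 / 1 * α) * α + α * α ≡ α * (1ℚ - α)
  collect = solve-∀ ℚ-ring
  f²≤f : ∀ x → f x * f x ≤ℚ f x
  f²≤f x = subst (f x * f x ≤ℚ_) (*-identityʳ (f x))
                 (*-monoˡ-≤-nonNeg (f x) {{nonNegative (0≤f x)}} (f≤1 x))
  pointwise : ∀ x → sq (centreᴳ d f) x ≤ℚ (1ℚ - 2α) * f x + α * α
  pointwise x = 0≤q-p⇒p≤q (subst (0ℚ ≤ℚ_) (sym (gap (f x) α)) (p≤q⇒0≤q-p (f²≤f x)))

Λᴳ-centreᴳ-≤ : ∀ d (f : G d → ℚ) → (∀ x → 0ℚ ≤ℚ f x) → (∀ x → f x ≤ℚ 1ℚ) →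
  let α = 𝔼 d f in Λᴳ d (centreᴳ d f) (centreᴳ d f) (centreᴳ d f) ≤ℚ ½ * (1ℚ - α) * (α * (1ℚ - α))
Λᴳ-centreᴳ-≤ d f 0≤f f≤1 = ≤-trans
  (Λᴳ-mean-zero-bound d (centreᴳ d f) (λ x → +-monoˡ-≤ (- α) (f≤1 x)) (𝔼-centreᴳ d f))
  (*-monoˡ-≤-nonNeg (½ * (1ℚ - α)) {{nonNegative 0≤½c}} (𝔼-sq-centreᴳ-≤ d f 0≤f f≤1))
  where
  α : ℚ
  α = 𝔼 d f
  0≤½c : 0ℚ ≤ℚ ½ * (1ℚ - α)
  0≤½c = *-nonNeg (nonNegative⁻¹ ½) (p≤q⇒0≤q-p (subst (α ≤ℚ_) (𝔼-const d 1ℚ) (𝔼-mono d f≤1)))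

lemma7p1 : (d : ℕ) → 1 ≤ d → (f : G d → ℚ) → (∀ x → (0ℚ ≤ℚ f x) × (f x ≤ℚ 1ℚ)) →
    let α = 𝔼 d f in
    𝔼 d (λ x → 𝔼 d (λ y → f x * (1ℚ - f (x +ᴳ y)) * (1ℚ - f (x +ᴳ (2· y)))))
      ≤ℚ (+ 3 / 2) * α * (1ℚ - α) * (1ℚ - α)
lemma7p1 d _ f 0≤f≤1 = begin
  Λᴳ d f (λ x → 1ℚ - f x) (λ x → 1ℚ - f x)
    ≡⟨ Λᴳ-complement d f ⟩
  α * (1ℚ - α) * (1ℚ - α) + Λᴳ d h h h
    ≤⟨ +-monoʳ-≤ (α * (1ℚ - α) * (1ℚ - α)) (Λᴳ-centreᴳ-≤ d f (proj₁ ∘ 0≤f≤1) (proj₂ ∘ 0≤f≤1)) ⟩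
  α * (1ℚ - α) * (1ℚ - α) + ½ * (1ℚ - α) * (α * (1ℚ - α))
    ≡⟨ collect α (1ℚ - α) ⟩
  (+ 3 / 2) * α * (1ℚ - α) * (1ℚ - α) ∎
  where
  open ≤-Reasoning
  α : ℚ
  α = 𝔼 d f
  h : G d → ℚ
  h = centreᴳ d f
  collect : ∀ α c → α * c * c + ½ * c * (α * c) ≡ (+ 3 / 2) * α * c * c
  collect = solve-∀ ℚ-ring
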